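{- Let $\pi\in S_n(123)$ and let $D_\pi$ be the Dyck path associated to $\pi$ by Krattenthaler's bijection (described in the context). Then $\pi$ is a backward derangement if and only if $D_\pi$ is hill-free.
   Context: Permutations are written in one-line notation $\pi=\pi_1\cdots\pi_n$. $S_n(123)$ is the set of permutations of $\{1,\dots,n\}$ avoiding the pattern $123$, i.e. having no indices $i<j<k$ with $\pi_i<\pi_j<\pi_k$. A permutation $\pi\in S_n$ is a backward derangement if $\pi_{n+1-i}\neq i$ for all $1\le i\le n$. A Dyck path of length $2n$ is a lattice path from $(0,0)$ to $(2n,0)$ consisting of up-steps $(1,1)$ and down-steps $(1,-1)$ never going below the $x$-axis. It contains a hill if it has a peak at height $1$ (an up-step from height $0$ to $1$ immediately followed by a down-step back to height $0$); it is hill-free if it contains no hill. Krattenthaler's bijection $\pi\mapsto D_\pi$ from $S_n(123)$ to Dyck paths of length $2n$: an entry $\pi_i$ is a right-to-left maximum if $\pi_i>\pi_j$ for all $j>i$. Let the right-to-left maxima be $m_1<m_2<\dots<m_s$ and write $\pi=w_s m_s w_{s-1}m_{s-1}\cdots w_1 m_1$ with $w_i$ (possibly empty) words. Set $m_0=0$. Build the path backwards, starting at $(2n,0)$ and ending at $(0,0)$, using backward up-steps $(-1,1)$ and backward down-steps $(-1,-1)$: read $\pi$ from right to left; for each $m_i$ perform $m_i-m_{i-1}$ backward up-steps, and for each $w_i$ perform $|w_i|+1$ backward down-steps. (E.g. $6573142$ gives the path $UUUDDDUUUDDUDD$ read left to right.) -}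

module Defs where

open import Data.Nat using (ℕ; zero; suc; _+_; _∸_; _≤_; _<_; _⊔_)
open import Data.Integer as ℤ using (ℤ)
open import Data.List using (List; []; _∷_; _++_; reverse; map; replicate; upTo; length; foldr; [_])
open import Data.List.Relation.Unary.All using (All; all?)
open import Data.List.Relation.Binary.Permutation.Propositional using (_↭_)
open import Data.List.Relation.Binary.Sublist.Propositional using (_⊆_)
open import Data.Maybe using (Maybe; just; nothing)
open import Data.Product using (Σ; _×_; ∃-syntax)
open import Relation.Binary.PropositionalEquality using (_≡_; _≢_)
open import Relation.Nullary using (¬_; yes; no)
open import Data.Nat.Properties using (_<?_)

IsPerm : ℕ → List ℕ → Set
IsPerm n π = π ↭ map suc (upTo n)

Avoids123 : List ℕ → Set
Avoids123 π = ¬ (∃[ a ] ∃[ b ] ∃[ c ] ((a ∷ b ∷ c ∷ []) ⊆ π × a < b × b < c))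

-- 1-based position lookup
at : List ℕ → ℕ → Maybe ℕ
at []       _             = nothing
at (x ∷ xs) zero          = nothing
at (x ∷ xs) (suc zero)    = just x
at (x ∷ xs) (suc (suc k)) = at xs (suc k)

BackwardDerangement : ℕ → List ℕ → Set
BackwardDerangement n π = ∀ i → 1 ≤ i → i ≤ n → at π (suc n ∸ i) ≢ just i

data Step : Set where
  U D : Step

-- backward steps: bUp = (-1,1), bDown = (-1,-1)
data BStep : Set where
  bUp bDown : BStep

maxL : List ℕ → ℕ
maxL = foldr _⊔_ 0

-- Reading π right to left. 'seen' = the entries to the right of the current one.
-- An entry x is a right-to-left maximum iff it exceeds every entry in 'seen';
-- then m_{i-1} = max of 'seen' (0 if empty), and we perform x - m_{i-1} backward
-- up-steps followed by one backward down-step (the "+1" of w_i);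
-- each entry of some w_i contributes one backward down-step.
krattBack : List ℕ → List ℕ → List BStep
krattBack seen []       = []
krattBack seen (x ∷ xs) with all? (_<? x) seen
... | yes _ = replicate (x ∸ maxL seen) bUp ++ bDown ∷ krattBack (x ∷ seen) xs
... | no  _ = bDown ∷ krattBack (x ∷ seen) xs

-- a backward up-step (-1,1) read left to right is a down-step, and vice versa
forward : BStep → Step
forward bUp   = D
forward bDown = U

Kratt : List ℕ → List Step
Kratt π = reverse (map forward (krattBack [] (reverse π)))

height : List Step → ℤ
height []      = ℤ.0ℤ
height (U ∷ s) = ℤ.1ℤ ℤ.+ height s
height (D ∷ s) = height s ℤ.- ℤ.1ℤ

HasHill : List Step → Set
HasHill p = ∃[ a ] ∃[ b ] (p ≡ a ++ U ∷ D ∷ b × height a ≡ ℤ.0ℤ)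

HillFree : List Step → Set
HillFree p = ¬ HasHill p

-- Mirrored left to right, D_π becomes the path of the backward steps in the order they are
-- generated, and mirroring preserves hills.  When the entry x at position p of reverse π is read,
-- that path has made M up-steps and p − 1 down-steps, M being the largest entry read so far; if x
-- is a right-to-left maximum it climbs to height x − p + 1, and otherwise it only descends.  So
-- D_π has a hill iff some right-to-left maximum i of π has exactly i − 1 entries to its right,
-- i.e. π_{n+1−i} = i.  For 123-avoiding π, every entry i = π_{n+1−i} is a right-to-left maximum.

module Submission where

open import Defs
open import Data.Nat using (ℕ; zero; suc; _+_; _∸_; _≤_; _<_; _⊔_; z≤n; s≤s; z<s)
open import Data.Nat.Properties
open import Data.Nat.ListAction using (sum)
open import Data.Nat.ListAction.Properties using (sum-++; sum-↭)
open import Data.Integer as ℤ using (_⊖_)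
import Data.Integer.Properties as ℤ
open import Data.List using (List; []; _∷_; _++_; [_]; reverse; map; replicate; upTo; downFrom; length; filter)
import Data.List.Properties as List
open import Data.List.Membership.Propositional using (_∈_; _∉_)
open import Data.List.Relation.Unary.All as All using (All; []; _∷_; all?)
import Data.List.Relation.Unary.Any as Any
open import Data.List.Relation.Unary.AllPairs using (_∷_)
open import Data.List.Relation.Unary.Unique.Propositional using (Unique)
open import Data.List.Relation.Unary.Unique.Propositional.Properties using (map⁺; downFrom⁺; Unique[x∷xs]⇒x∉xs)
open import Data.List.Relation.Binary.Permutation.Propositional using (_↭_; ↭-sym; ↭-trans; ↭-reflexive; ↭⇒↭ₛ)
open import Data.List.Relation.Binary.Permutation.Propositional.Properties using (All-resp-↭; filter-↭; ↭-length; ↭-reverse)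
import Data.List.Relation.Binary.Permutation.Setoid.Properties as Permutationₛ
open import Data.List.Relation.Binary.Sublist.Propositional using (_∷_; from∈)
open import Data.List.Relation.Binary.Sublist.Propositional.Properties using (++⁺)
open import Data.Product using (_×_; _,_; ∃-syntax)
open import Data.Sum using (_⊎_; inj₁; inj₂)
open import Data.Maybe using (just)
open import Function using (_∘_; _⇔_; mk⇔; Equivalence)
open import Function.Construct.Composition using (_⇔-∘_)
open import Function.Related.TypeIsomorphisms using (¬-cong-⇔)
open import Function.Related.Propositional using (module EquationalReasoning)
open import Relation.Binary.PropositionalEquality hiding ([_])
open import Relation.Nullary using (¬_; yes; no; contradiction)

private
  variable
    A B : Set

reverse-++-∷ : ∀ (xs : List A) x ys → reverse (xs ++ x ∷ ys) ≡ reverse ys ++ x ∷ reverse xs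
reverse-++-∷ xs x ys = begin
  reverse (xs ++ x ∷ ys)               ≡⟨ List.reverse-++ xs (x ∷ ys) ⟩
  reverse (x ∷ ys) ++ reverse xs       ≡⟨ cong (_++ reverse xs) (List.unfold-reverse x ys) ⟩
  (reverse ys ++ [ x ]) ++ reverse xs  ≡⟨ List.++-assoc (reverse ys) [ x ] (reverse xs) ⟩
  reverse ys ++ x ∷ reverse xs         ∎
  where open ≡-Reasoning

reverse-map-++-∷-∷ : ∀ (f : A → B) xs x y ys →
  reverse (map f (xs ++ x ∷ y ∷ ys)) ≡ reverse (map f ys) ++ f y ∷ f x ∷ reverse (map f xs)
reverse-map-++-∷-∷ f xs x y ys = begin
  reverse (map f (xs ++ x ∷ y ∷ ys))                    ≡⟨ cong reverse (List.map-++ f xs (x ∷ y ∷ ys)) ⟩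
  reverse (map f xs ++ f x ∷ f y ∷ map f ys)            ≡⟨ reverse-++-∷ (map f xs) (f x) _ ⟩
  reverse (f y ∷ map f ys) ++ f x ∷ reverse (map f xs)  ≡⟨ cong (_++ _) (List.unfold-reverse (f y) (map f ys)) ⟩
  (reverse (map f ys) ++ [ f y ]) ++ f x ∷ reverse (map f xs)
                                                       ≡⟨ List.++-assoc (reverse (map f ys)) [ f y ] _ ⟩
  reverse (map f ys) ++ f y ∷ f x ∷ reverse (map f xs)  ∎
  where open ≡-Reasoning

reverse-map-inverse : ∀ {f : A → B} {g : B → A} → (∀ x → g (f x) ≡ x) →
  ∀ xs → reverse (map g (reverse (map f xs))) ≡ xs
reverse-map-inverse {f = f} {g} g∘f≗id xs = begin
  reverse (map g (reverse (map f xs)))  ≡⟨ cong reverse (List.reverse-map g (map f xs)) ⟩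
  reverse (reverse (map g (map f xs)))  ≡⟨ List.reverse-involutive _ ⟩
  map g (map f xs)                      ≡⟨ List.map-∘ xs ⟨
  map (g ∘ f) xs                        ≡⟨ List.map-cong g∘f≗id xs ⟩
  map (λ x → x) xs                      ≡⟨ List.map-id xs ⟩
  xs                                    ∎
  where open ≡-Reasoning

sum-map-++ : ∀ (w : A → ℕ) xs ys → sum (map w (xs ++ ys)) ≡ sum (map w xs) + sum (map w ys)
sum-map-++ w xs ys = trans (cong sum (List.map-++ w xs ys)) (sum-++ (map w xs) (map w ys))

sum-map-reverse : ∀ (w : A → ℕ) xs → sum (map w (reverse xs)) ≡ sum (map w xs)
sum-map-reverse w xs = trans (cong sum (List.reverse-map w xs)) (sum-↭ (↭-reverse (map w xs)))

m+[n∸m]≡n⊔m : ∀ m n → m + (n ∸ m) ≡ n ⊔ m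
m+[n∸m]≡n⊔m zero    n       = sym (⊔-identityʳ n)
m+[n∸m]≡n⊔m (suc m) zero    = +-identityʳ (suc m)
m+[n∸m]≡n⊔m (suc m) (suc n) = cong suc (m+[n∸m]≡n⊔m m n)

Unique-++⁻ʳ : ∀ (xs : List A) {ys} → Unique (xs ++ ys) → Unique ys
Unique-++⁻ʳ []       u       = u
Unique-++⁻ʳ (_ ∷ xs) (_ ∷ u) = Unique-++⁻ʳ xs u

-- Dyck paths and their mirror images

#U #D : List Step → ℕ
#U = sum ∘ map λ { U → 1 ; D → 0 }
#D = sum ∘ map λ { U → 0 ; D → 1 }

height≡#U⊖#D : ∀ q → height q ≡ #U q ⊖ #D q
height≡#U⊖#D []      = refl
height≡#U⊖#D (U ∷ q) = trans (cong (λ h → ℤ.1ℤ ℤ.+ h) (height≡#U⊖#D q))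
  (ℤ.distribʳ-⊖-+-pos 1 (#U q) (#D q))
height≡#U⊖#D (D ∷ q) = trans (cong (λ h → h ℤ.- ℤ.1ℤ) (height≡#U⊖#D q))
  (trans (ℤ.distribˡ-⊖-+-neg 0 (#U q) (#D q)) (cong (λ k → #U q ⊖ suc k) (+-identityʳ (#D q))))

m⊖n≡0⇔m≡n : ∀ m n → m ⊖ n ≡ ℤ.0ℤ ⇔ m ≡ n
m⊖n≡0⇔m≡n m n = mk⇔
  (λ m⊖n≡0 → ℤ.+-injective (ℤ.i-j≡0⇒i≡j (ℤ.+ m) (ℤ.+ n) (trans (ℤ.[+m]-[+n]≡m⊖n m n) m⊖n≡0)))
  (λ { refl → ℤ.n⊖n≡0 m })

height≡0⇔balanced : ∀ q → height q ≡ ℤ.0ℤ ⇔ #U q ≡ #D q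
height≡0⇔balanced q =
  m⊖n≡0⇔m≡n (#U q) (#D q) ⇔-∘ mk⇔ (trans (sym (height≡#U⊖#D q))) (trans (height≡#U⊖#D q))

ups downs : List BStep → ℕ
ups bs   = #D (map forward bs)
downs bs = #U (map forward bs)

Balanced : List BStep → Set
Balanced bs = ups bs ≡ downs bs

ups-++ : ∀ as bs → ups (as ++ bs) ≡ ups as + ups bs
ups-++ as bs = trans (cong #D (List.map-++ forward as bs)) (sum-map-++ _ (map forward as) _)

downs-++ : ∀ as bs → downs (as ++ bs) ≡ downs as + downs bs
downs-++ as bs = trans (cong #U (List.map-++ forward as bs)) (sum-map-++ _ (map forward as) _)

balanced-around-hill : ∀ as bs → Balanced (as ++ bUp ∷ bDown ∷ bs) → Balanced as ⇔ Balanced bs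
balanced-around-hill as bs balanced = mk⇔
  (λ as-bal → suc-injective (+-cancelˡ-≡ (downs as) _ _
    (subst (λ k → k + suc (ups bs) ≡ downs as + suc (downs bs)) as-bal total)))
  (λ bs-bal → +-cancelʳ-≡ (suc (downs bs)) _ _
    (subst (λ k → ups as + suc k ≡ downs as + suc (downs bs)) bs-bal total))
  where
  total : ups as + suc (ups bs) ≡ downs as + suc (downs bs)
  total = trans (sym (ups-++ as _)) (trans balanced (downs-++ as _))

mirror : List BStep → List Step
mirror bs = reverse (map forward bs)

backward : Step → BStep
backward U = bDown
backward D = bUp

unmirror : List Step → List BStep
unmirror q = reverse (map backward q)

unmirror-mirror : ∀ bs → unmirror (mirror bs) ≡ bs
unmirror-mirror = reverse-map-inverse λ { bUp → refl ; bDown → refl }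

mirror-unmirror : ∀ q → mirror (unmirror q) ≡ q
mirror-unmirror = reverse-map-inverse λ { U → refl ; D → refl }

#U-mirror : ∀ bs → #U (mirror bs) ≡ downs bs
#U-mirror bs = sum-map-reverse _ (map forward bs)

#D-mirror : ∀ bs → #D (mirror bs) ≡ ups bs
#D-mirror bs = sum-map-reverse _ (map forward bs)

-- Hill u d bs: the path bs, started at height u − d, has a peak at height 1.
data Hill : ℕ → ℕ → List BStep → Set where
  hill : ∀ {u d bs} → u ≡ d → Hill u d (bUp ∷ bDown ∷ bs)
  up   : ∀ {u d bs} → Hill (suc u) d bs → Hill u d (bUp ∷ bs)
  down : ∀ {u d bs} → Hill u (suc d) bs → Hill u d (bDown ∷ bs)

Hill⇒split : ∀ {u d bs} → Hill u d bs →
  ∃[ as ] ∃[ cs ] (bs ≡ as ++ bUp ∷ bDown ∷ cs × u + ups as ≡ d + downs as)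
Hill⇒split (hill {bs = cs} u≡d) = [] , cs , refl , cong (_+ 0) u≡d
Hill⇒split {u} (up h) with Hill⇒split h
... | as , cs , refl , balance = bUp ∷ as , cs , refl , trans (+-suc u (ups as)) balance
Hill⇒split {d = d} (down h) with Hill⇒split h
... | as , cs , refl , balance = bDown ∷ as , cs , refl , trans balance (sym (+-suc d (downs as)))

split⇒Hill : ∀ {u d} as {cs} → u + ups as ≡ d + downs as → Hill u d (as ++ bUp ∷ bDown ∷ cs)
split⇒Hill {u} {d} []          balance = hill (+-cancelʳ-≡ 0 u d balance)
split⇒Hill {u}     (bUp ∷ as)   balance = up (split⇒Hill as (trans (sym (+-suc u (ups as))) balance))
split⇒Hill {d = d} (bDown ∷ as) balance = down (split⇒Hill as (trans balance (+-suc d (downs as))))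

Hill⇔HasHill-mirror : ∀ {bs} → Balanced bs → Hill 0 0 bs ⇔ HasHill (mirror bs)
Hill⇔HasHill-mirror {bs} balanced = mk⇔ to from
  where
  to : Hill 0 0 bs → HasHill (mirror bs)
  to h with Hill⇒split h
  ... | as , cs , refl , as-balanced =
    mirror cs , mirror as , reverse-map-++-∷-∷ forward as bUp bDown cs ,
    Equivalence.from (height≡0⇔balanced (mirror cs))
      (trans (#U-mirror cs) (trans (sym cs-balanced) (sym (#D-mirror cs))))
    where
    cs-balanced : Balanced cs
    cs-balanced = Equivalence.to (balanced-around-hill as cs balanced) as-balanced

  from : HasHill (mirror bs) → Hill 0 0 bs
  from (p , q , mirror≡ , height≡0) = subst (Hill 0 0) bs≡ (split⇒Hill as as-balanced)
    where
    as cs : List BStep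
    as = unmirror q
    cs = unmirror p

    bs≡ : as ++ bUp ∷ bDown ∷ cs ≡ bs
    bs≡ = trans (sym (reverse-map-++-∷-∷ backward p U D q))
            (trans (cong unmirror (sym mirror≡)) (unmirror-mirror bs))

    cs-balanced : Balanced cs
    cs-balanced = begin
      ups cs           ≡⟨ #D-mirror cs ⟨
      #D (mirror cs)   ≡⟨ cong #D (mirror-unmirror p) ⟩
      #D p             ≡⟨ Equivalence.to (height≡0⇔balanced p) height≡0 ⟨
      #U p             ≡⟨ cong #U (mirror-unmirror p) ⟨
      #U (mirror cs)   ≡⟨ #U-mirror cs ⟩
      downs cs         ∎
      where open ≡-Reasoning

    as-balanced : Balanced as
    as-balanced = Equivalence.from
      (balanced-around-hill as cs (subst Balanced (sym bs≡) balanced)) cs-balanced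

-- Krattenthaler's bijection

-- Every entry x contributes x ∸ M up-steps and one down-step, M being the largest entry read
-- so far; for an entry that is not a right-to-left maximum, x ∸ M = 0.
kratt : ℕ → List ℕ → List BStep
kratt M []       = []
kratt M (x ∷ xs) = replicate (x ∸ M) bUp ++ bDown ∷ kratt (x ⊔ M) xs

maxL-upper : ∀ xs → All (_≤ maxL xs) xs
maxL-upper []       = []
maxL-upper (x ∷ xs) =
  m≤m⊔n x (maxL xs) ∷ All.map (λ y≤max → ≤-trans y≤max (m≤n⊔m x (maxL xs))) (maxL-upper xs)

krattBack≡kratt : ∀ seen xs → krattBack seen xs ≡ kratt (maxL seen) xs
krattBack≡kratt seen []       = refl
krattBack≡kratt seen (x ∷ xs) with all? (_<? x) seen
... | yes _ = cong (λ r → replicate (x ∸ maxL seen) bUp ++ bDown ∷ r) (krattBack≡kratt (x ∷ seen) xs)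
... | no not-all-below =
  cong₂ (λ k r → replicate k bUp ++ bDown ∷ r) (sym (m≤n⇒m∸n≡0 x≤max)) (krattBack≡kratt (x ∷ seen) xs)
  where
  x≤max : x ≤ maxL seen
  x≤max = ≮⇒≥ λ max<x → not-all-below (All.map (λ y≤max → ≤-<-trans y≤max max<x) (maxL-upper seen))

ups-run : ∀ k bs → ups (replicate k bUp ++ bs) ≡ k + ups bs
ups-run zero    bs = refl
ups-run (suc k) bs = cong suc (ups-run k bs)

downs-run : ∀ k bs → downs (replicate k bUp ++ bs) ≡ downs bs
downs-run zero    bs = refl
downs-run (suc k) bs = downs-run k bs

ups-kratt : ∀ M xs → M + ups (kratt M xs) ≡ maxL xs ⊔ M
ups-kratt M []       = +-identityʳ M
ups-kratt M (x ∷ xs) = begin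
  M + ups (replicate (x ∸ M) bUp ++ bDown ∷ kratt (x ⊔ M) xs) ≡⟨ cong (M +_) (ups-run (x ∸ M) _) ⟩
  M + (x ∸ M + ups (kratt (x ⊔ M) xs))                       ≡⟨ +-assoc M (x ∸ M) _ ⟨
  M + (x ∸ M) + ups (kratt (x ⊔ M) xs)                       ≡⟨ cong (_+ ups (kratt (x ⊔ M) xs)) (m+[n∸m]≡n⊔m M x) ⟩
  x ⊔ M + ups (kratt (x ⊔ M) xs)                             ≡⟨ ups-kratt (x ⊔ M) xs ⟩
  maxL xs ⊔ (x ⊔ M)                                          ≡⟨ ⊔-assoc (maxL xs) x M ⟨
  maxL xs ⊔ x ⊔ M                                            ≡⟨ cong (_⊔ M) (⊔-comm (maxL xs) x) ⟩
  x ⊔ maxL xs ⊔ M                                            ∎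
  where open ≡-Reasoning

downs-kratt : ∀ M xs → downs (kratt M xs) ≡ length xs
downs-kratt M []       = refl
downs-kratt M (x ∷ xs) = trans (downs-run (x ∸ M) _) (cong suc (downs-kratt (x ⊔ M) xs))

Hill-run⁻ : ∀ {u d} k {bs} → Hill u d (replicate k bUp ++ bDown ∷ bs) →
  (∃[ j ] (k ≡ suc j × u + j ≡ d)) ⊎ Hill (u + k) (suc d) bs
Hill-run⁻ {u} zero       (down h) = inj₂ (subst (λ m → Hill m _ _) (sym (+-identityʳ u)) h)
Hill-run⁻ {u} (suc zero) (hill e) = inj₁ (0 , refl , trans (+-identityʳ u) e)
Hill-run⁻ {u} {d} (suc k) {bs} (up h) with Hill-run⁻ k h
... | inj₁ (j , refl , e) = inj₁ (suc j , refl , trans (+-suc u j) e)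
... | inj₂ h′             = inj₂ (subst (λ m → Hill m (suc d) bs) (sym (+-suc u k)) h′)

Hill-run⁺ : ∀ {u d} k {bs} → (∃[ j ] (k ≡ suc j × u + j ≡ d)) ⊎ Hill (u + k) (suc d) bs →
  Hill u d (replicate k bUp ++ bDown ∷ bs)
Hill-run⁺ {u} (suc zero)    (inj₁ (zero , refl , e))  = hill (trans (sym (+-identityʳ u)) e)
Hill-run⁺ {u} (suc (suc j)) (inj₁ (suc j , refl , e)) =
  up (Hill-run⁺ (suc j) (inj₁ (j , refl , trans (sym (+-suc u j)) e)))
Hill-run⁺ {u} zero          (inj₂ h) = down (subst (λ m → Hill m _ _) (+-identityʳ u) h)
Hill-run⁺ {u} {d} (suc k) {bs} (inj₂ h) =
  up (Hill-run⁺ k (inj₂ (subst (λ m → Hill m (suc d) bs) (+-suc u k) h)))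

-- positions in xs are numbered from d + 1
HasFixedPoint : ℕ → List ℕ → Set
HasFixedPoint d xs = ∃[ ys ] ∃[ x ] ∃[ zs ] (xs ≡ ys ++ x ∷ zs × x ≡ d + suc (length ys))

Hill-kratt⇒HasFixedPoint : ∀ {M d} xs → Hill M d (kratt M xs) → HasFixedPoint d xs
Hill-kratt⇒HasFixedPoint {M} {d} (x ∷ xs) h with Hill-run⁻ (x ∸ M) h
... | inj₁ (j , x∸M≡1+j , M+j≡d) = [] , x , xs , refl , x≡d+1
  where
  M<x : M < x
  M<x = m∸n≢0⇒n<m λ x∸M≡0 → 0≢1+n (trans (sym x∸M≡0) x∸M≡1+j)
  x≡d+1 : x ≡ d + 1
  x≡d+1 = begin
    x             ≡⟨ m+[n∸m]≡n (<⇒≤ M<x) ⟨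
    M + (x ∸ M)   ≡⟨ cong (M +_) x∸M≡1+j ⟩
    M + suc j     ≡⟨ +-suc M j ⟩
    suc (M + j)   ≡⟨ cong suc M+j≡d ⟩
    suc d         ≡⟨ +-comm 1 d ⟩
    d + 1         ∎
    where open ≡-Reasoning
... | inj₂ h′
  with Hill-kratt⇒HasFixedPoint xs (subst (λ m → Hill m (suc d) (kratt (x ⊔ M) xs)) (m+[n∸m]≡n⊔m M x) h′)
...   | ys , y , zs , refl , y≡ = x ∷ ys , y , zs , refl , trans y≡ (sym (+-suc d (suc (length ys))))

rightToLeftMax-fixedPoint⇒Hill-kratt : ∀ {M d} ys {x zs} →
  x ≡ d + suc (length ys) → M < x → All (_< x) ys →
  Hill M d (kratt M (ys ++ x ∷ zs))
rightToLeftMax-fixedPoint⇒Hill-kratt {M} {d} [] {x} x≡d+1 M<x [] =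
  Hill-run⁺ (x ∸ M) (inj₁ (d ∸ M , x∸M≡1+[d∸M] , m+[n∸m]≡n M≤d))
  where
  x≡1+d : x ≡ suc d
  x≡1+d = trans x≡d+1 (+-comm d 1)
  M≤d : M ≤ d
  M≤d = ≤-pred (subst (M <_) x≡1+d M<x)
  x∸M≡1+[d∸M] : x ∸ M ≡ suc (d ∸ M)
  x∸M≡1+[d∸M] = trans (cong (_∸ M) x≡1+d) (+-∸-assoc 1 M≤d)
rightToLeftMax-fixedPoint⇒Hill-kratt {M} {d} (y ∷ ys) {x} {zs} x≡ M<x (y<x ∷ ys<x) =
  Hill-run⁺ (y ∸ M) (inj₂ (subst (λ m → Hill m (suc d) (kratt (y ⊔ M) (ys ++ x ∷ zs)))
    (sym (m+[n∸m]≡n⊔m M y))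
    (rightToLeftMax-fixedPoint⇒Hill-kratt ys (trans x≡ (+-suc d (suc (length ys)))) (⊔-lub y<x M<x) ys<x)))

-- Permutations of 1, …, n

descending : ℕ → List ℕ
descending n = map suc (downFrom n)

IsPerm⇒↭descending : ∀ {n π} → IsPerm n π → π ↭ descending n
IsPerm⇒↭descending {n} π↭ = ↭-trans π↭ (↭-trans (↭-sym (↭-reverse (map suc (upTo n))))
  (↭-reflexive (trans (sym (List.reverse-map suc (upTo n))) (cong (map suc) (List.reverse-upTo n)))))

length-descending : ∀ n → length (descending n) ≡ n
length-descending n = trans (List.length-map suc (downFrom n)) (List.length-downFrom n)

maxL-descending : ∀ n → maxL (descending n) ≡ n
maxL-descending zero    = refl
maxL-descending (suc n) = trans (cong (suc n ⊔_) (maxL-descending n)) (m≥n⇒m⊔n≡m (n≤1+n n))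

maxL-↭ : ∀ {xs ys} → xs ↭ ys → maxL xs ≡ maxL ys
maxL-↭ σ = Permutationₛ.foldr-commMonoid (setoid ℕ) ⊔-0-isCommutativeMonoid (↭⇒↭ₛ σ)

Unique-descending : ∀ n → Unique (descending n)
Unique-descending n = map⁺ suc-injective (downFrom⁺ n)

countBelow : ℕ → List ℕ → ℕ
countBelow i xs = length (filter (_<? i) xs)

countBelow-↭ : ∀ i {xs ys} → xs ↭ ys → countBelow i xs ≡ countBelow i ys
countBelow-↭ i σ = ↭-length (filter-↭ (_<? i) σ)

countBelow-descending-all : ∀ {i} n → n < i → countBelow i (descending n) ≡ n
countBelow-descending-all         zero    _   = refl
countBelow-descending-all {i} (suc n) n<i =
  trans (cong length (List.filter-accept (_<? i) n<i))
    (cong suc (countBelow-descending-all n (<-trans (n<1+n n) n<i)))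

countBelow-descending : ∀ {m} n → m ≤ n → countBelow (suc m) (descending n) ≡ m
countBelow-descending         zero    z≤n = refl
countBelow-descending {m} (suc n) m≤1+n with suc n <? suc m
... | yes 1+n<1+m = trans (cong length (List.filter-accept (_<? suc m) 1+n<1+m))
  (trans (cong suc (countBelow-descending-all n (<-trans (n<1+n n) 1+n<1+m))) (≤-antisym (≤-pred 1+n<1+m) m≤1+n))
... | no 1+n≮1+m = trans (cong length (List.filter-reject (_<? suc m) 1+n≮1+m))
  (countBelow-descending n (≤-pred (≮⇒≥ 1+n≮1+m)))

Balanced-kratt : ∀ {n ρ} → ρ ↭ descending n → Balanced (kratt 0 ρ)
Balanced-kratt {n} {ρ} σ = begin
  ups (kratt 0 ρ)        ≡⟨ ups-kratt 0 ρ ⟩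
  maxL ρ ⊔ 0             ≡⟨ ⊔-identityʳ (maxL ρ) ⟩
  maxL ρ                 ≡⟨ maxL-↭ σ ⟩
  maxL (descending n)    ≡⟨ maxL-descending n ⟩
  n                      ≡⟨ length-descending n ⟨
  length (descending n)  ≡⟨ ↭-length σ ⟨
  length ρ               ≡⟨ downs-kratt 0 ρ ⟨
  downs (kratt 0 ρ)      ∎
  where open ≡-Reasoning

-- π_{n+1−i} = i: some entry i has exactly i − 1 entries to its right
HasBackwardFixedPoint : List ℕ → Set
HasBackwardFixedPoint π = ∃[ as ] ∃[ x ] ∃[ bs ] (π ≡ as ++ x ∷ bs × x ≡ suc (length bs))

-- An entry b > i after i forces every entry before i above i (no 123), so all i − 1 entries
-- below i would have to share the i − 1 places after i with b.
avoids123⇒below-backwardFixedPoint : ∀ {n} as {i} bs → (as ++ i ∷ bs) ↭ descending n →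
  Avoids123 (as ++ i ∷ bs) → i ≡ suc (length bs) → All (_< i) bs
avoids123⇒below-backwardFixedPoint {n} as {i} bs σ avoids refl = All.tabulate below
  where
  i∉bs : i ∉ bs
  i∉bs = Unique[x∷xs]⇒x∉xs
    (Unique-++⁻ʳ as (Permutationₛ.Unique-resp-↭ (setoid ℕ) (↭⇒↭ₛ (↭-sym σ)) (Unique-descending n)))

  length-bs≤n : length bs ≤ n
  length-bs≤n = begin
    length bs                   ≤⟨ n≤1+n (length bs) ⟩
    suc (length bs)             ≤⟨ m≤n+m (suc (length bs)) (length as) ⟩
    length as + suc (length bs) ≡⟨ List.length-++ as ⟨
    length (as ++ i ∷ bs)       ≡⟨ ↭-length σ ⟩
    length (descending n)       ≡⟨ length-descending n ⟩
    n                           ∎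
    where open ≤-Reasoning

  below : ∀ {b} → b ∈ bs → b < i
  below {b} b∈bs with b <? i
  ... | yes b<i = b<i
  ... | no  b≮i = contradiction (trans (sym count-bs) count-all)
                    (<⇒≢ (List.filter-notAll (_<? i) bs (Any.map (λ { refl → b≮i }) b∈bs)))
    where
    i<b : i < b
    i<b = ≤∧≢⇒< (≮⇒≥ b≮i) λ i≡b → i∉bs (subst (_∈ bs) (sym i≡b) b∈bs)

    nothing-below-in-as : All (λ a → ¬ a < i) as
    nothing-below-in-as = All.tabulate λ a∈as a<i →
      avoids (_ , i , b , ++⁺ (from∈ a∈as) (refl ∷ from∈ b∈bs) , a<i , i<b)

    count-bs : countBelow i (as ++ i ∷ bs) ≡ countBelow i bs
    count-bs = begin
      length (filter (_<? i) (as ++ i ∷ bs))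
        ≡⟨ cong length (List.filter-++ (_<? i) as (i ∷ bs)) ⟩
      length (filter (_<? i) as ++ filter (_<? i) (i ∷ bs))
        ≡⟨ cong (λ l → length (l ++ filter (_<? i) (i ∷ bs))) (List.filter-none (_<? i) nothing-below-in-as) ⟩
      length (filter (_<? i) (i ∷ bs))
        ≡⟨ cong length (List.filter-reject (_<? i) (<-irrefl refl)) ⟩
      countBelow i bs ∎
      where open ≡-Reasoning

    count-all : countBelow i (as ++ i ∷ bs) ≡ length bs
    count-all = trans (countBelow-↭ i σ) (countBelow-descending n length-bs≤n)

HasFixedPoint-reverse⇒HasBackwardFixedPoint : ∀ π → HasFixedPoint 0 (reverse π) → HasBackwardFixedPoint π
HasFixedPoint-reverse⇒HasBackwardFixedPoint π (ys , x , zs , reverse-π≡ , x≡) =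
  reverse zs , x , reverse ys , π≡ , trans x≡ (cong suc (sym (List.length-reverse ys)))
  where
  π≡ : π ≡ reverse zs ++ x ∷ reverse ys
  π≡ = trans (sym (List.reverse-involutive π)) (trans (cong reverse reverse-π≡) (reverse-++-∷ ys x zs))

HasBackwardFixedPoint⇔Hill-kratt : ∀ {n π} → π ↭ descending n → Avoids123 π →
  HasBackwardFixedPoint π ⇔ Hill 0 0 (kratt 0 (reverse π))
HasBackwardFixedPoint⇔Hill-kratt {π = π} σ avoids =
  mk⇔ to (HasFixedPoint-reverse⇒HasBackwardFixedPoint π ∘ Hill-kratt⇒HasFixedPoint (reverse π))
  where
  to : HasBackwardFixedPoint π → Hill 0 0 (kratt 0 (reverse π))
  to (as , x , bs , refl , x≡) = subst (Hill 0 0 ∘ kratt 0) (sym (reverse-++-∷ as x bs))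
    (rightToLeftMax-fixedPoint⇒Hill-kratt (reverse bs) (trans x≡ (cong suc (sym (List.length-reverse bs))))
      (subst (0 <_) (sym x≡) z<s)
      (All-resp-↭ (↭-sym (↭-reverse bs)) (avoids123⇒below-backwardFixedPoint as bs σ avoids x≡)))

-- Backward derangements

at-++-∷ : ∀ xs x ys → at (xs ++ x ∷ ys) (suc (length xs)) ≡ just x
at-++-∷ []       x ys = refl
at-++-∷ (_ ∷ xs) x ys = at-++-∷ xs x ys

at≡just⇒split : ∀ xs k {x} → at xs (suc k) ≡ just x →
  ∃[ ys ] ∃[ zs ] (xs ≡ ys ++ x ∷ zs × length ys ≡ k)
at≡just⇒split (y ∷ xs) zero    refl = [] , xs , refl , refl
at≡just⇒split (y ∷ xs) (suc k) at≡ with at≡just⇒split xs k at≡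
... | ys , zs , refl , refl = y ∷ ys , zs , refl , refl

BackwardDerangement⇔¬HasBackwardFixedPoint : ∀ {n π} → length π ≡ n →
  BackwardDerangement n π ⇔ (¬ HasBackwardFixedPoint π)
BackwardDerangement⇔¬HasBackwardFixedPoint {n} {π} length-π = mk⇔ to from
  where
  to : BackwardDerangement n π → ¬ HasBackwardFixedPoint π
  to derangement (as , _ , bs , refl , refl) = derangement (suc (length bs)) (s≤s z≤n) x≤n at≡
    where
    n≡ : n ≡ suc (length as + length bs)
    n≡ = trans (sym length-π) (trans (List.length-++ as) (+-suc (length as) (length bs)))
    x≤n : suc (length bs) ≤ n
    x≤n = subst (suc (length bs) ≤_) (sym n≡) (s≤s (m≤n+m (length bs) (length as)))
    at≡ : at π (suc n ∸ suc (length bs)) ≡ just (suc (length bs))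
    at≡ = trans (cong (at π) (trans (cong (_∸ length bs) n≡) (m+n∸n≡m (suc (length as)) (length bs))))
                (at-++-∷ as _ bs)

  from : ¬ HasBackwardFixedPoint π → BackwardDerangement n π
  from no-fixed-point i _ i≤n at≡
    with at≡just⇒split π (n ∸ i) (subst (λ k → at π k ≡ just i) (+-∸-assoc 1 i≤n) at≡)
  ... | as , bs , refl , length-as = no-fixed-point (as , i , bs , refl , i≡)
    where
    i≡ : i ≡ suc (length bs)
    i≡ = +-cancelˡ-≡ (n ∸ i) i (suc (length bs)) (begin
      n ∸ i + i                   ≡⟨ m∸n+n≡m i≤n ⟩
      n                           ≡⟨ length-π ⟨
      length (as ++ i ∷ bs)       ≡⟨ List.length-++ as ⟩
      length as + suc (length bs) ≡⟨ cong (_+ suc (length bs)) length-as ⟩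
      n ∸ i + suc (length bs)     ∎)
      where open ≡-Reasoning

theorem3p2 : (n : ℕ) (π : List ℕ) → IsPerm n π → Avoids123 π →
             (BackwardDerangement n π ⇔ HillFree (Kratt π))
theorem3p2 n π isPerm avoids = begin
  BackwardDerangement n π                  ∼⟨ BackwardDerangement⇔¬HasBackwardFixedPoint length-π ⟩
  ¬ HasBackwardFixedPoint π                ∼⟨ ¬-cong-⇔ (HasBackwardFixedPoint⇔Hill-kratt σ avoids) ⟩
  ¬ Hill 0 0 (kratt 0 (reverse π))         ∼⟨ ¬-cong-⇔ (Hill⇔HasHill-mirror (Balanced-kratt reverse-σ)) ⟩
  ¬ HasHill (mirror (kratt 0 (reverse π))) ≡⟨ cong (¬_ ∘ HasHill ∘ mirror) (krattBack≡kratt [] (reverse π)) ⟨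
  HillFree (Kratt π)                       ∎
  where
  open EquationalReasoning
  σ : π ↭ descending n
  σ = IsPerm⇒↭descending isPerm
  reverse-σ : reverse π ↭ descending n
  reverse-σ = ↭-trans (↭-reverse π) σ
  length-π : length π ≡ n
  length-π = trans (↭-length σ) (length-descending n)
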